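{- Let $p$ be a prime, $q=p^n$ with $q\equiv 1\pmod 3$, $\delta\in\mathbb{F}_q$ a cubic nonresidue, and let $\mathbb{H}_q$ with its $\mathrm{GL}_3(\mathbb{F}_q)$-action be as in the context. Let $G_\gamma$ be the subgroup of $\mathrm{GL}_3(\mathbb{F}_q)$ consisting of all invertible matrices of the form $\begin{bmatrix} x & y & 0\\ w & z & 0\\ 0 & 0 & t\end{bmatrix}$ (the centralizer of $\gamma=\mathrm{diag}(a,a,b)$ with $a\neq b$). Then the set \[ \{(u+\delta^{1/3},\ v+\delta^{2/3}) : u,v\in\mathbb{F}_q\} \] is a fundamental domain for the action of $G_\gamma$ on $\mathbb{H}_q$, i.e. it contains exactly one element of each $G_\gamma$-orbit.
   Context: $\mathbb{F}_q(\sqrt[3]{\delta})\cong\mathbb{F}_{q^3}$ has $\mathbb{F}_q$-basis $\{1,\delta^{1/3},\delta^{2/3}\}$; write $\alpha=\alpha_1+\alpha_2\delta^{1/3}+\alpha_3\delta^{2/3}$ with $\alpha_i\in\mathbb{F}_q$. $\mathbb{H}_q=\{(\alpha,\beta)\in\mathbb{F}_q(\sqrt[3]{\delta})^2 : \alpha_2\beta_3-\alpha_3\beta_2\neq 0\}$, with $\mathrm{GL}_3(\mathbb{F}_q)$ acting by $\begin{bmatrix} a & b & c\\ d & e & f\\ r & s & t\end{bmatrix}(\alpha,\beta)=\left(\frac{a\alpha+b\beta+c}{r\alpha+s\beta+t},\frac{d\alpha+e\beta+f}{r\alpha+s\beta+t}\right)$. -}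

module Defs where

open import Level using (0ℓ)
open import Data.Nat using (ℕ)
open import Data.Fin using (Fin)
import Data.Fin as Fin
open import Data.Product using (Σ; ∃; _×_; _,_)
open import Relation.Binary.PropositionalEquality using (_≡_; _≢_)
open import Relation.Nullary using (¬_)
open import Function.Bundles using (_↔_)
open import Algebra.Structures using (IsCommutativeRing)

record FiniteField (q : ℕ) : Set₁ where
  field
    Carrier : Set
    _+_ _*_ : Carrier → Carrier → Carrier
    -_      : Carrier → Carrier
    0# 1#   : Carrier
    isCommutativeRing : IsCommutativeRing _≡_ _+_ _*_ -_ 0# 1#
    0≢1     : 0# ≢ 1#
    inverse : ∀ x → x ≢ 0# → Σ Carrier (λ y → x * y ≡ 1#)
    card    : Carrier ↔ Fin q

  infixl 6 _+_ _-_
  infixl 7 _*_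

  _-_ : Carrier → Carrier → Carrier
  x - y = x + (- y)

i₀ i₁ i₂ : Fin 3
i₀ = Fin.zero
i₁ = Fin.suc Fin.zero
i₂ = Fin.suc (Fin.suc Fin.zero)

module Cubic {q : ℕ} (F : FiniteField q) where
  open FiniteField F

  CubicNonresidue : Carrier → Set
  CubicNonresidue δ = ¬ (Σ Carrier λ x → x * x * x ≡ δ)

  -- Elements α = α₁ + α₂ δ^{1/3} + α₃ δ^{2/3} of F_q(δ^{1/3}) as triples over F_q.
  record Ext : Set where
    constructor ⟨_,_,_⟩
    field
      c₁ c₂ c₃ : Carrier
  open Ext public

  module _ (δ : Carrier) where
    infixl 6 _⊕_
    infixl 7 _⊗_
    infixr 8 _·_
    -- arithmetic in F_q(δ^{1/3}) = F_q[θ]/(θ³ - δ)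
    _⊕_ : Ext → Ext → Ext
    ⟨ a₁ , a₂ , a₃ ⟩ ⊕ ⟨ b₁ , b₂ , b₃ ⟩ = ⟨ a₁ + b₁ , a₂ + b₂ , a₃ + b₃ ⟩

    _⊗_ : Ext → Ext → Ext
    ⟨ a₁ , a₂ , a₃ ⟩ ⊗ ⟨ b₁ , b₂ , b₃ ⟩ =
      ⟨ a₁ * b₁ + δ * (a₂ * b₃ + a₃ * b₂)
      , a₁ * b₂ + a₂ * b₁ + δ * (a₃ * b₃)
      , a₁ * b₃ + a₂ * b₂ + a₃ * b₁ ⟩

    ι : Carrier → Ext
    ι a = ⟨ a , 0# , 0# ⟩

    _·_ : Carrier → Ext → Ext
    a · ⟨ b₁ , b₂ , b₃ ⟩ = ⟨ a * b₁ , a * b₂ , a * b₃ ⟩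

    InH : Ext × Ext → Set
    InH (α , β) = c₂ α * c₃ β - c₃ α * c₂ β ≢ 0#

    -- 3×3 matrices over F_q, entries indexed by (row, column)
    Mat3 : Set
    Mat3 = Fin 3 → Fin 3 → Carrier

    det3 : Mat3 → Carrier
    det3 m = m i₀ i₀ * (m i₁ i₁ * m i₂ i₂ - m i₁ i₂ * m i₂ i₁)
           - m i₀ i₁ * (m i₁ i₀ * m i₂ i₂ - m i₁ i₂ * m i₂ i₀)
           + m i₀ i₂ * (m i₁ i₀ * m i₂ i₁ - m i₁ i₁ * m i₂ i₀)

    InGL3 : Mat3 → Set
    InGL3 m = det3 m ≢ 0#

    InGγ : Mat3 → Set
    InGγ m = InGL3 m × (m i₀ i₂ ≡ 0# × m i₁ i₂ ≡ 0# × m i₂ i₀ ≡ 0# × m i₂ i₁ ≡ 0#)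

    -- m · (α , β) ≡ (α' , β') for the GL₃ action by fractional linear maps:
    -- the denominator D = rα + sβ + t is nonzero, and α' = N₁ / D, β' = N₂ / D
    -- (expressed as α' D = N₁, β' D = N₂, division being by a nonzero element).
    Acts : Mat3 → Ext × Ext → Ext × Ext → Set
    Acts m (α , β) (α' , β') =
      let D  = (m i₂ i₀ · α) ⊕ (m i₂ i₁ · β) ⊕ ι (m i₂ i₂)
          N₁ = (m i₀ i₀ · α) ⊕ (m i₀ i₁ · β) ⊕ ι (m i₀ i₂)
          N₂ = (m i₁ i₀ · α) ⊕ (m i₁ i₁ · β) ⊕ ι (m i₁ i₂)
      in ¬ (D ≡ ι 0#) × (α' ⊗ D ≡ N₁) × (β' ⊗ D ≡ N₂)

    dom : Carrier → Carrier → Ext × Ext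
    dom u v = ⟨ u , 1# , 0# ⟩ , ⟨ v , 0# , 1# ⟩

    FundamentalDomainGγ : Set
    FundamentalDomainGγ =
      (∀ u v → InH (dom u v))
      × (∀ P → InH P → Σ Carrier λ u → Σ Carrier λ v → Σ Mat3 λ g →
            InGγ g × Acts g P (dom u v))
      × (∀ u v u' v' (g : Mat3) → InGγ g → Acts g (dom u v) (dom u' v') →
            (u ≡ u') × (v ≡ v'))

-- An element [[x,y,0],[w,z,0],[0,0,t]] of G_γ has the scalar t as denominator, so it acts on each of
-- the three coordinates of (α, β) by the same linear map t⁻¹ [[x,y],[w,z]] of F_q². The condition
-- defining H_q says that the δ^{1/3}- and δ^{2/3}-coordinates of (α, β) form an invertible matrix N,
-- and the domain is exactly where N = 1. Hence the adjugate of N, with t = det N, moves (α, β) into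
-- the domain, and an element of G_γ relating two domain points acts as the identity, so it also
-- preserves the remaining coordinates (u, v).
module Submission where

open import Defs
open import Algebra.Bundles using (CommutativeRing)
open import Data.Integer.Base as ℤ using (ℤ; +_; -[1+_]; _⊖_; sign; ∣_∣; _◃_)
import Data.Integer.Properties as ℤ
open import Data.Maybe.Base using (just; nothing)
open import Data.Nat.Base as ℕ using (ℕ; zero; suc; _^_; _%_)
import Data.Nat.Properties as ℕ
open import Data.Nat.Primality using (Prime)
open import Data.Sign.Base as Sign using (Sign)
open import Data.Vec.Base using (Vec; []; _∷_; lookup)
open import Function.Bundles using (_⇔_; mk⇔; Equivalence)
open import Level using (0ℓ)
open import Relation.Binary.Definitions using (WeaklyDecidable)
open import Relation.Binary.PropositionalEquality as ≡ using (_≡_; _≢_; cong; cong₂)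
open import Relation.Nullary.Decidable.Core using (yes; no)

module IntegerCoefficients {c ℓ} (R : CommutativeRing c ℓ) where
  open CommutativeRing R
  open import Algebra.Properties.Semiring.Mult.TCOptimised semiring using (_×_; 1+×; ×-homo-+; ×1-homo-*)
  open import Algebra.Properties.Ring ring using (-0#≈0#; -‿involutive; -‿distribˡ-*; -‿distribʳ-*; -‿+-comm)
  open import Algebra.Properties.CommutativeSemigroup +-commutativeSemigroup using (interchange)
  open import Algebra.Solver.Ring.AlmostCommutativeRing
    using (fromCommutativeRing; _-Raw-AlmostCommutative⟶_; Induced-equivalence)
  open import Relation.Binary.Reasoning.Setoid setoid

  signed : Sign → Carrier → Carrier
  signed Sign.+ x = x
  signed Sign.- x = - x

  -- The optimised multiple _×_ makes the constants :0 and :1 below denote 0# and 1# literally.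
  ⟦_⟧ℤ : ℤ → Carrier
  ⟦ i ⟧ℤ = signed (sign i) (∣ i ∣ × 1#)

  private
    1+x-[1+y]≈x-y : ∀ x y → (1# + x) - (1# + y) ≈ x - y
    1+x-[1+y]≈x-y x y = begin
      (1# + x) - (1# + y)      ≈⟨ +-congˡ (-‿+-comm 1# y) ⟨
      (1# + x) + (- 1# + - y)  ≈⟨ interchange 1# x (- 1#) (- y) ⟩
      (1# - 1#) + (x - y)      ≈⟨ +-congʳ (-‿inverseʳ 1#) ⟩
      0# + (x - y)             ≈⟨ +-identityˡ (x - y) ⟩
      x - y                    ∎

  ⟦⊖⟧ : ∀ m n → ⟦ m ⊖ n ⟧ℤ ≈ m × 1# - n × 1#
  ⟦⊖⟧ zero    zero    = sym (trans (+-congˡ -0#≈0#) (+-identityʳ 0#))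
  ⟦⊖⟧ (suc m) zero    = sym (trans (+-congˡ -0#≈0#) (+-identityʳ _))
  ⟦⊖⟧ zero    (suc n) = sym (+-identityˡ _)
  ⟦⊖⟧ (suc m) (suc n) = begin
    ⟦ suc m ⊖ suc n ⟧ℤ           ≡⟨ ≡.cong ⟦_⟧ℤ (ℤ.[1+m]⊖[1+n]≡m⊖n m n) ⟩
    ⟦ m ⊖ n ⟧ℤ                   ≈⟨ ⟦⊖⟧ m n ⟩
    m × 1# - n × 1#              ≈⟨ 1+x-[1+y]≈x-y _ _ ⟨
    (1# + m × 1#) - (1# + n × 1#) ≈⟨ +-cong (1+× m 1#) (-‿cong (1+× n 1#)) ⟨
    suc m × 1# - suc n × 1#      ∎

  ⟦+⟧ : ∀ i j → ⟦ i ℤ.+ j ⟧ℤ ≈ ⟦ i ⟧ℤ + ⟦ j ⟧ℤ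
  ⟦+⟧ (+ m)    (+ n)    = ×-homo-+ 1# m n
  ⟦+⟧ (+ m)    -[1+ n ] = ⟦⊖⟧ m (suc n)
  ⟦+⟧ -[1+ m ] (+ n)    = trans (⟦⊖⟧ n (suc m)) (+-comm _ _)
  ⟦+⟧ -[1+ m ] -[1+ n ] = begin
    - (suc (suc (m ℕ.+ n)) × 1#)         ≡⟨ ≡.cong (λ k → - (suc k × 1#)) (ℕ.+-suc m n) ⟨
    - ((suc m ℕ.+ suc n) × 1#)           ≈⟨ -‿cong (×-homo-+ 1# (suc m) (suc n)) ⟩
    - (suc m × 1# + suc n × 1#)          ≈⟨ -‿+-comm _ _ ⟨
    - (suc m × 1#) + - (suc n × 1#)      ∎

  ⟦◃⟧ : ∀ s n → ⟦ s ◃ n ⟧ℤ ≈ signed s (n × 1#)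
  ⟦◃⟧ Sign.+ zero    = refl
  ⟦◃⟧ Sign.- zero    = sym -0#≈0#
  ⟦◃⟧ Sign.+ (suc n) = refl
  ⟦◃⟧ Sign.- (suc n) = refl

  signed-* : ∀ s t x y → signed (s Sign.* t) (x * y) ≈ signed s x * signed t y
  signed-* Sign.+ Sign.+ x y = refl
  signed-* Sign.+ Sign.- x y = -‿distribʳ-* x y
  signed-* Sign.- Sign.+ x y = -‿distribˡ-* x y
  signed-* Sign.- Sign.- x y = begin
    x * y          ≈⟨ -‿involutive (x * y) ⟨
    - - (x * y)    ≈⟨ -‿cong (-‿distribˡ-* x y) ⟩
    - (- x * y)    ≈⟨ -‿distribʳ-* (- x) y ⟩
    - x * - y      ∎

  ⟦*⟧ : ∀ i j → ⟦ i ℤ.* j ⟧ℤ ≈ ⟦ i ⟧ℤ * ⟦ j ⟧ℤ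
  ⟦*⟧ i j = begin
    ⟦ (sign i Sign.* sign j) ◃ (∣ i ∣ ℕ.* ∣ j ∣) ⟧ℤ          ≈⟨ ⟦◃⟧ (sign i Sign.* sign j) (∣ i ∣ ℕ.* ∣ j ∣) ⟩
    signed (sign i Sign.* sign j) ((∣ i ∣ ℕ.* ∣ j ∣) × 1#)  ≈⟨ signed-cong (sign i Sign.* sign j) (×1-homo-* ∣ i ∣ ∣ j ∣) ⟩
    signed (sign i Sign.* sign j) (∣ i ∣ × 1# * ∣ j ∣ × 1#) ≈⟨ signed-* (sign i) (sign j) _ _ ⟩
    ⟦ i ⟧ℤ * ⟦ j ⟧ℤ                                         ∎
    where
    signed-cong : ∀ s {x y} → x ≈ y → signed s x ≈ signed s y
    signed-cong Sign.+ x≈y = x≈y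
    signed-cong Sign.- x≈y = -‿cong x≈y

  ⟦-⟧ : ∀ i → ⟦ ℤ.- i ⟧ℤ ≈ - ⟦ i ⟧ℤ
  ⟦-⟧ (+ zero)  = sym -0#≈0#
  ⟦-⟧ (+ suc n) = refl
  ⟦-⟧ -[1+ n ]  = sym (-‿involutive _)

  ℤ-morphism : ℤ.+-*-rawRing -Raw-AlmostCommutative⟶ fromCommutativeRing R
  ℤ-morphism = record
    { ⟦_⟧    = ⟦_⟧ℤ
    ; +-homo = ⟦+⟧
    ; *-homo = ⟦*⟧
    ; -‿homo = ⟦-⟧
    ; 0-homo = refl
    ; 1-homo = refl
    }

  _≟ℤ_ : WeaklyDecidable (Induced-equivalence ℤ-morphism)
  i ≟ℤ j with i ℤ.≟ j
  ... | yes ≡.refl = just refl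
  ... | no _       = nothing

  open import Algebra.Solver.Ring ℤ.+-*-rawRing (fromCommutativeRing R) ℤ-morphism _≟ℤ_ public
    using (Polynomial; solve; _:=_; con; _:+_; _:*_; _:-_; :-_)

  :0 :1 : ∀ {n} → Polynomial n
  :0 = con (+ 0)
  :1 = con (+ 1)

module GγFundamentalDomain {q : ℕ} (F : FiniteField q) (δ : FiniteField.Carrier F) where
  open import Data.Product.Base using (Σ; _×_; _,_)
  open FiniteField F
  open Cubic F hiding (_⊕_; _⊗_; _·_; ι)

  ring : CommutativeRing 0ℓ 0ℓ
  ring = record { isCommutativeRing = isCommutativeRing }

  open CommutativeRing ring using (*-comm; *-assoc; *-identityˡ; *-identityʳ; +-identityʳ; zeroʳ)
  open IntegerCoefficients ring using (solve; _:=_; :0; :1; _:+_; _:*_; _:-_; :-_)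
  open ≡.≡-Reasoning

  infixl 6 _⊕_
  infixl 7 _⊗_
  infixr 8 _·_

  _⊕_ _⊗_ : Ext → Ext → Ext
  _⊕_ = Cubic._⊕_ F δ
  _⊗_ = Cubic._⊗_ F δ

  _·_ : Carrier → Ext → Ext
  _·_ = Cubic._·_ F δ

  ι : Carrier → Ext
  ι = Cubic.ι F δ

  ⟨,,⟩-cong : ∀ {a₁ a₂ a₃ b₁ b₂ b₃} → a₁ ≡ b₁ → a₂ ≡ b₂ → a₃ ≡ b₃ → ⟨ a₁ , a₂ , a₃ ⟩ ≡ ⟨ b₁ , b₂ , b₃ ⟩
  ⟨,,⟩-cong ≡.refl ≡.refl ≡.refl = ≡.refl

  *-cancelˡ : ∀ {t x y} → t ≢ 0# → t * x ≡ t * y → x ≡ y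
  *-cancelˡ {t} {x} {y} t≢0 tx≡ty with inverse t t≢0
  ... | s , ts≡1 = begin
    x            ≡⟨ cancel x ⟨
    s * (t * x)  ≡⟨ cong (s *_) tx≡ty ⟩
    s * (t * y)  ≡⟨ cancel y ⟩
    y            ∎
    where
    cancel : ∀ z → s * (t * z) ≡ z
    cancel z = begin
      s * (t * z)  ≡⟨ *-assoc s t z ⟨
      s * t * z    ≡⟨ cong (_* z) (≡.trans (*-comm s t) ts≡1) ⟩
      1# * z       ≡⟨ *-identityˡ z ⟩
      z            ∎

  x≢0⇒x*x≢0 : ∀ {x} → x ≢ 0# → x * x ≢ 0#
  x≢0⇒x*x≢0 {x} x≢0 xx≡0 = x≢0 (*-cancelˡ x≢0 (≡.trans xx≡0 (≡.sym (zeroʳ x))))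

  ⊗-ι : ∀ γ t → γ ⊗ ι t ≡ t · γ
  ⊗-ι ⟨ a₁ , a₂ , a₃ ⟩ t = ⟨,,⟩-cong
    (solve 5 (λ a₁ a₂ a₃ t d → a₁ :* t :+ d :* (a₂ :* :0 :+ a₃ :* :0) := t :* a₁) ≡.refl a₁ a₂ a₃ t δ)
    (solve 5 (λ a₁ a₂ a₃ t d → a₁ :* :0 :+ a₂ :* t :+ d :* (a₃ :* :0) := t :* a₂) ≡.refl a₁ a₂ a₃ t δ)
    (solve 4 (λ a₁ a₂ a₃ t → a₁ :* :0 :+ a₂ :* :0 :+ a₃ :* t := t :* a₃) ≡.refl a₁ a₂ a₃ t)

  ⊕-ι0 : ∀ γ → γ ⊕ ι 0# ≡ γ
  ⊕-ι0 ⟨ a₁ , a₂ , a₃ ⟩ = ⟨,,⟩-cong (+-identityʳ a₁) (+-identityʳ a₂) (+-identityʳ a₃)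

  0·⊕0·⊕ι : ∀ α β t → 0# · α ⊕ 0# · β ⊕ ι t ≡ ι t
  0·⊕0·⊕ι ⟨ a₁ , a₂ , a₃ ⟩ ⟨ b₁ , b₂ , b₃ ⟩ t = ⟨,,⟩-cong (0a+0b+c≡c a₁ b₁ t) (0a+0b+c≡c a₂ b₂ 0#) (0a+0b+c≡c a₃ b₃ 0#)
    where
    0a+0b+c≡c : ∀ a b c → 0# * a + 0# * b + c ≡ c
    0a+0b+c≡c = solve 3 (λ a b c → :0 :* a :+ :0 :* b :+ c := c) ≡.refl

  -- t (α', β') = (x α + y β, w α + z β): the action of [[x,y,0],[w,z,0],[0,0,t]] cleared of denominators.
  BlockAction : (x y w z t : Carrier) → Ext × Ext → Ext × Ext → Set
  BlockAction x y w z t (α , β) (α' , β') = t ≢ 0# × t · α' ≡ x · α ⊕ y · β × t · β' ≡ w · α ⊕ z · β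

  acts⇔blockAction : ∀ g {α β α' β'} → g i₀ i₂ ≡ 0# → g i₁ i₂ ≡ 0# → g i₂ i₀ ≡ 0# → g i₂ i₁ ≡ 0# →
    Acts δ g (α , β) (α' , β') ⇔ BlockAction (g i₀ i₀) (g i₀ i₁) (g i₁ i₀) (g i₁ i₁) (g i₂ i₂) (α , β) (α' , β')
  acts⇔blockAction g {α} {β} {α'} {β'} g₀₂≡0 g₁₂≡0 g₂₀≡0 g₂₁≡0 = mk⇔ to from
    where
    t : Carrier
    t = g i₂ i₂

    D≡ιt : g i₂ i₀ · α ⊕ g i₂ i₁ · β ⊕ ι t ≡ ι t
    D≡ιt = ≡.trans (cong₂ (λ r s → r · α ⊕ s · β ⊕ ι t) g₂₀≡0 g₂₁≡0) (0·⊕0·⊕ι α β t)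

    cleared : ∀ γ → γ ⊗ (g i₂ i₀ · α ⊕ g i₂ i₁ · β ⊕ ι t) ≡ t · γ
    cleared γ = ≡.trans (cong (γ ⊗_) D≡ιt) (⊗-ι γ t)

    numerator : ∀ {a b c} → c ≡ 0# → a · α ⊕ b · β ⊕ ι c ≡ a · α ⊕ b · β
    numerator c≡0 = ≡.trans (cong (λ c → _ ⊕ ι c) c≡0) (⊕-ι0 _)

    to : Acts δ g (α , β) (α' , β') →
         BlockAction (g i₀ i₀) (g i₀ i₁) (g i₁ i₀) (g i₁ i₁) t (α , β) (α' , β')
    to (D≢0 , eq₁ , eq₂) =
        (λ t≡0 → D≢0 (≡.trans D≡ιt (cong ι t≡0)))
      , ≡.trans (≡.sym (cleared α')) (≡.trans eq₁ (numerator g₀₂≡0))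
      , ≡.trans (≡.sym (cleared β')) (≡.trans eq₂ (numerator g₁₂≡0))

    from : BlockAction (g i₀ i₀) (g i₀ i₁) (g i₁ i₀) (g i₁ i₁) t (α , β) (α' , β') →
           Acts δ g (α , β) (α' , β')
    from (t≢0 , eq₁ , eq₂) =
        (λ D≡0 → t≢0 (cong c₁ (≡.trans (≡.sym D≡ιt) D≡0)))
      , ≡.trans (cleared α') (≡.trans eq₁ (≡.sym (numerator g₀₂≡0)))
      , ≡.trans (cleared β') (≡.trans eq₂ (≡.sym (numerator g₁₂≡0)))

  dom-InH : ∀ u v → InH δ (dom δ u v)
  dom-InH _ _ Δ≡0 = 0≢1 (≡.trans (≡.sym Δ≡0) 1·1-0·0≡1)
    where
    1·1-0·0≡1 : 1# * 1# - 0# * 0# ≡ 1#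
    1·1-0·0≡1 = solve 0 (:1 :* :1 :- :0 :* :0 := :1) ≡.refl

  block : (x y w z t : Carrier) → Mat3 δ
  block x y w z t i j = lookup (lookup rows i) j
    where
    rows : Vec (Vec Carrier 3) 3
    rows = (x ∷ y ∷ 0# ∷ []) ∷ (w ∷ z ∷ 0# ∷ []) ∷ (0# ∷ 0# ∷ t ∷ []) ∷ []

  det3-block : ∀ x y w z t → det3 δ (block x y w z t) ≡ (x * z - y * w) * t
  det3-block = solve 5 (λ x y w z t →
      x :* (z :* t :- :0 :* :0) :- y :* (w :* t :- :0 :* :0)
        :+ :0 :* (w :* :0 :- z :* :0)
    := (x :* z :- y :* w) :* t) ≡.refl

  -- [[x, y], [w, z]] is the adjugate of [[α₂, α₃], [β₂, β₃]] and t its determinant.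
  adjugate-blockAction : ∀ α β → InH δ (α , β) → Σ Carrier λ u → Σ Carrier λ v →
    BlockAction (c₃ β) (- c₃ α) (- c₂ β) (c₂ α) (c₂ α * c₃ β - c₃ α * c₂ β) (α , β) (dom δ u v)
  adjugate-blockAction ⟨ a₁ , a₂ , a₃ ⟩ ⟨ b₁ , b₂ , b₃ ⟩ Δ≢0 with inverse _ Δ≢0
  ... | s , Δs≡1 =
      s * (b₃ * a₁ + - a₃ * b₁) , s * (- b₂ * a₁ + a₂ * b₁) , Δ≢0
    , ⟨,,⟩-cong (Δ[s*c]≡c _)
        (solve 4 (λ a₂ a₃ b₂ b₃ → (a₂ :* b₃ :- a₃ :* b₂) :* :1 := b₃ :* a₂ :+ :- a₃ :* b₂) ≡.refl a₂ a₃ b₂ b₃)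
        (solve 4 (λ a₂ a₃ b₂ b₃ → (a₂ :* b₃ :- a₃ :* b₂) :* :0 := b₃ :* a₃ :+ :- a₃ :* b₃) ≡.refl a₂ a₃ b₂ b₃)
    , ⟨,,⟩-cong (Δ[s*c]≡c _)
        (solve 4 (λ a₂ a₃ b₂ b₃ → (a₂ :* b₃ :- a₃ :* b₂) :* :0 := :- b₂ :* a₂ :+ a₂ :* b₂) ≡.refl a₂ a₃ b₂ b₃)
        (solve 4 (λ a₂ a₃ b₂ b₃ → (a₂ :* b₃ :- a₃ :* b₂) :* :1 := :- b₂ :* a₃ :+ a₂ :* b₃) ≡.refl a₂ a₃ b₂ b₃)
    where
    Δ : Carrier
    Δ = a₂ * b₃ - a₃ * b₂
    Δ[s*c]≡c : ∀ c → Δ * (s * c) ≡ c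
    Δ[s*c]≡c c = begin
      Δ * (s * c)  ≡⟨ *-assoc Δ s c ⟨
      Δ * s * c    ≡⟨ cong (_* c) Δs≡1 ⟩
      1# * c       ≡⟨ *-identityˡ c ⟩
      c            ∎

  every-orbit-meets-dom : ∀ P → InH δ P → Σ Carrier λ u → Σ Carrier λ v → Σ (Mat3 δ) λ g →
    InGγ δ g × Acts δ g P (dom δ u v)
  every-orbit-meets-dom (α , β) Δ≢0 with adjugate-blockAction α β Δ≢0
  ... | u , v , act =
    u , v , g , (det≢0 , ≡.refl , ≡.refl , ≡.refl , ≡.refl) ,
    Equivalence.from (acts⇔blockAction g ≡.refl ≡.refl ≡.refl ≡.refl) act
    where
    Δ : Carrier
    Δ = c₂ α * c₃ β - c₃ α * c₂ β
    g : Mat3 δ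
    g = block (c₃ β) (- c₃ α) (- c₂ β) (c₂ α) Δ
    det≢0 : det3 δ g ≢ 0#
    det≢0 det≡0 = x≢0⇒x*x≢0 Δ≢0 (begin
      Δ * Δ                                        ≡⟨ adjugate-det (c₂ α) (c₃ α) (c₂ β) (c₃ β) ⟩
      (c₃ β * c₂ α - - c₃ α * - c₂ β) * Δ          ≡⟨ det3-block (c₃ β) (- c₃ α) (- c₂ β) (c₂ α) Δ ⟨
      det3 δ g                                     ≡⟨ det≡0 ⟩
      0#                                           ∎)
      where
      adjugate-det : ∀ a₂ a₃ b₂ b₃ → let Δ = a₂ * b₃ - a₃ * b₂ in Δ * Δ ≡ (b₃ * a₂ - - a₃ * - b₂) * Δ
      adjugate-det = solve 4 (λ a₂ a₃ b₂ b₃ → (a₂ :* b₃ :- a₃ :* b₂) :* (a₂ :* b₃ :- a₃ :* b₂)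
                                           := (b₃ :* a₂ :- :- a₃ :* :- b₂) :* (a₂ :* b₃ :- a₃ :* b₂)) ≡.refl

  blockAction-dom-injective : ∀ {x y w z t u v u' v'} →
    BlockAction x y w z t (dom δ u v) (dom δ u' v') → u ≡ u' × v ≡ v'
  blockAction-dom-injective {x} {y} {w} {z} {t} {u} {v} {u'} {v'} (t≢0 , eq₁ , eq₂) =
    *-cancelˡ t≢0 (begin
      t * u            ≡⟨ a≡a+0·b (t * u) v ⟩
      t * u + 0# * v   ≡⟨ cong₂ (λ a b → a * u + b * v) x≡t y≡0 ⟨
      x * u + y * v    ≡⟨ cong c₁ eq₁ ⟨
      t * u'           ∎) ,
    *-cancelˡ t≢0 (begin
      t * v            ≡⟨ a≡0·b+a (t * v) u ⟩
      0# * u + t * v   ≡⟨ cong₂ (λ a b → a * u + b * v) w≡0 z≡t ⟨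
      w * u + z * v    ≡⟨ cong c₁ eq₂ ⟨
      t * v'           ∎)
    where
    a·1+b·0≡a : ∀ a b → a * 1# + b * 0# ≡ a
    a·1+b·0≡a = solve 2 (λ a b → a :* :1 :+ b :* :0 := a) ≡.refl
    a·0+b·1≡b : ∀ a b → a * 0# + b * 1# ≡ b
    a·0+b·1≡b = solve 2 (λ a b → a :* :0 :+ b :* :1 := b) ≡.refl
    a≡a+0·b : ∀ a b → a ≡ a + 0# * b
    a≡a+0·b = solve 2 (λ a b → a := a :+ :0 :* b) ≡.refl
    a≡0·b+a : ∀ a b → a ≡ 0# * b + a
    a≡0·b+a = solve 2 (λ a b → a := :0 :* b :+ a) ≡.refl
    x≡t : x ≡ t
    x≡t = ≡.trans (≡.sym (a·1+b·0≡a x y)) (≡.trans (≡.sym (cong c₂ eq₁)) (*-identityʳ t))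
    y≡0 : y ≡ 0#
    y≡0 = ≡.trans (≡.sym (a·0+b·1≡b x y)) (≡.trans (≡.sym (cong c₃ eq₁)) (zeroʳ t))
    w≡0 : w ≡ 0#
    w≡0 = ≡.trans (≡.sym (a·1+b·0≡a w z)) (≡.trans (≡.sym (cong c₂ eq₂)) (zeroʳ t))
    z≡t : z ≡ t
    z≡t = ≡.trans (≡.sym (a·0+b·1≡b w z)) (≡.trans (≡.sym (cong c₃ eq₂)) (*-identityʳ t))

  dom-meets-orbit-once : ∀ u v u' v' (g : Mat3 δ) → InGγ δ g → Acts δ g (dom δ u v) (dom δ u' v') →
    u ≡ u' × v ≡ v'
  dom-meets-orbit-once u v u' v' g (_ , g₀₂≡0 , g₁₂≡0 , g₂₀≡0 , g₂₁≡0) act =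
    blockAction-dom-injective (Equivalence.to (acts⇔blockAction g g₀₂≡0 g₁₂≡0 g₂₀≡0 g₂₁≡0) act)

  isFundamentalDomain : FundamentalDomainGγ δ
  isFundamentalDomain = dom-InH , every-orbit-meets-dom , dom-meets-orbit-once

proposition4p1 : (p n q : ℕ) → Prime p → q ≡ p ^ n → q % 3 ≡ 1 →
    (F : FiniteField q) → (δ : FiniteField.Carrier F) → Cubic.CubicNonresidue F δ →
    Cubic.FundamentalDomainGγ F δ
proposition4p1 _ _ _ _ _ _ F δ _ = GγFundamentalDomain.isFundamentalDomain F δ
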